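{- Let $\Gamma$ be a finite abelian group (written additively, identity $0$) and let $H=\{\eta_1,\dots,\eta_h\}\subseteq\Gamma$ be a generating set of $\Gamma$. Let $\Pi$ be a Cayley poset with elements $(\gamma_1,j_1),\dots,(\gamma_\ell,j_\ell)$ (with $\gamma_i\in\Gamma$, $j_i\in\mathbb{Z}$) and suppose $\Pi$ is strongly diamond-free. Let $N$ be an $n$-element weighted set with weight function $w:N\to H$. Then the family $$\mathcal{F}(N,w,\Pi):=\bigcup_{i=1}^{\ell}\{A\subseteq N:\ |A|=\lfloor n/2\rfloor+j_i \text{ and } w(A)=\gamma_i\}$$ is diamond-free (with respect to the subset relation).
   Context: Infinite Cayley poset $P(\Gamma,H)$: its elements are pairs $(\gamma,i)$ with $\gamma\in\Gamma$, $i\in\mathbb{Z}$, ordered by $(\gamma,i)\preceq(\delta,j)$ iff $j\ge i$ and $\delta=\gamma+\eta'_1+\dots+\eta'_{j-i}$ for some $\eta'_1,\dots,\eta'_{j-i}\in H$. A Cayley poset is a finite subset of $P(\Gamma,H)$ with the induced order. A poset (or family of sets ordered by inclusion) is diamond-free if it contains no four distinct elements $a,b,c,d$ with $a\le b\le d$ and $a\le c\le d$ (i.e., no weak copy of the diamond $A<B_1,B_2<C$). Three distinct elements $(\gamma_1,i_1)\prec(\gamma_2,i_2)\prec(\gamma_3,i_3)$ of a Cayley poset form a strong chain if there is some $\eta\in H$ such that $\gamma_2-\gamma_1$ can be written as a sum of $i_2-i_1$ elements of $H$ with $\eta$ among the terms, and $\gamma_3-\gamma_2$ can be written as a sum of $i_3-i_2$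 elements of $H$ with $\eta$ among the terms. A Cayley poset is strongly diamond-free if it is diamond-free and contains no strong chain. A weighted $n$-element set is an $n$-element set $N$ partitioned into classes $N_1,\dots,N_h$ (of sizes $n_1,\dots,n_h$) with weight $w(x)=\eta_k$ for all $x\in N_k$; for $A\subseteq N$, $w(A)=\sum_{x\in A}w(x)$. -}

module Defs where

open import Level using (Level; _⊔_)
open import Algebra.Bundles using (AbelianGroup)
open import Data.Nat as ℕ using (ℕ; zero; suc)
open import Data.Nat.DivMod using (_/_)
open import Data.Integer as ℤ using (ℤ; +_)
open import Data.Fin using (Fin; zero; suc)
open import Data.Fin.Subset using (Subset; _⊆_; ∣_∣; inside; outside)
open import Data.Vec using ([]; _∷_)
open import Data.List using (List)
open import Data.List.Relation.Unary.Any using (Any)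
open import Data.Bool using (true; false)
open import Data.Product using (Σ; ∃; ∃-syntax; _×_; _,_)
open import Relation.Binary.PropositionalEquality using (_≡_)
open import Relation.Nullary using (¬_)

module _ {c ℓ : Level} (G : AbelianGroup c ℓ) where
  open AbelianGroup G

  IsFinite : Set (c ⊔ ℓ)
  IsFinite = Σ (List Carrier) λ xs → ∀ x → Any (x ≈_) xs

  sumF : (k : ℕ) → (Fin k → Carrier) → Carrier
  sumF zero    f = ε
  sumF (suc k) f = f zero ∙ sumF k (λ t → f (suc t))

  sumL : List Carrier → Carrier
  sumL Data.List.[] = ε
  sumL (x Data.List.∷ xs) = x ∙ sumL xs

  Generates : (h : ℕ) → (Fin h → Carrier) → Set (c ⊔ ℓ)
  Generates h η = ∀ γ → Σ (List Carrier) λ xs →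
    (Data.List.Relation.Unary.All.All (λ x → ∃[ k ] (x ≈ η k ⊎ x ≈ η k ⁻¹)) xs)
    × (γ ≈ sumL xs)
    where open import Data.Sum using (_⊎_)
          import Data.List.Relation.Unary.All

  module _ {h : ℕ} (η : Fin h → Carrier) where

    Elem : Set c
    Elem = Carrier × ℤ

    SumStep : Carrier → ℕ → Carrier → Set ℓ
    SumStep γ k δ = Σ (Fin k → Fin h) λ f → δ ≈ γ ∙ sumF k (λ t → η (f t))

    SumStepWith : Fin h → Carrier → ℕ → Carrier → Set ℓ
    SumStepWith e γ k δ = Σ (Fin k → Fin h) λ f →
      (∃[ t ] η (f t) ≈ η e) × (δ ≈ γ ∙ sumF k (λ t → η (f t)))

    _⪯_ : Elem → Elem → Set ℓ
    (γ , i) ⪯ (δ , j) = ∃[ k ] (j ≡ i ℤ.+ + k × SumStep γ k δ)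

    _≋_ : Elem → Elem → Set ℓ
    (γ , i) ≋ (δ , j) = γ ≈ δ × i ≡ j

    _≺_ : Elem → Elem → Set ℓ
    a ≺ b = a ⪯ b × ¬ (a ≋ b)

    DiamondFreeCP : (l : ℕ) → (Fin l → Elem) → Set ℓ
    DiamondFreeCP l Π = ∀ (a b c' d : Fin l) →
      ¬ (Π a ≋ Π b) → ¬ (Π a ≋ Π c') → ¬ (Π a ≋ Π d) →
      ¬ (Π b ≋ Π c') → ¬ (Π b ≋ Π d) → ¬ (Π c' ≋ Π d) →
      ¬ (Π a ⪯ Π b × Π b ⪯ Π d × Π a ⪯ Π c' × Π c' ⪯ Π d)

    StrongChain : Elem → Elem → Elem → Set ℓ
    StrongChain (γ₁ , i₁) (γ₂ , i₂) (γ₃ , i₃) =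
      ((γ₁ , i₁) ≺ (γ₂ , i₂)) × ((γ₂ , i₂) ≺ (γ₃ , i₃)) ×
      ¬ ((γ₁ , i₁) ≋ (γ₃ , i₃)) ×
      ∃[ e ] ( (∃[ k ] (i₂ ≡ i₁ ℤ.+ + k × SumStepWith e γ₁ k γ₂))
             × (∃[ k ] (i₃ ≡ i₂ ℤ.+ + k × SumStepWith e γ₂ k γ₃)))

    StronglyDiamondFree : (l : ℕ) → (Fin l → Elem) → Set ℓ
    StronglyDiamondFree l Π = DiamondFreeCP l Π ×
      (∀ (a b c' : Fin l) → ¬ StrongChain (Π a) (Π b) (Π c'))

    -- weighted n-element set N = Fin n; w x is the index of the class of x,
    -- whose weight is η (w x).  Weight of a subset A ⊆ N:
    weight : {n : ℕ} → (Fin n → Fin h) → Subset n → Carrier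
    weight {zero}  w []            = ε
    weight {suc n} w (inside ∷ A)  = η (w zero) ∙ weight (λ x → w (suc x)) A
    weight {suc n} w (outside ∷ A) = weight (λ x → w (suc x)) A

    InF : (n : ℕ) → (Fin n → Fin h) → (l : ℕ) → (Fin l → Elem) → Subset n → Set ℓ
    InF n w l Π A = ∃[ i ] (let (γ , j) = Π i in
      (+ ∣ A ∣ ≡ + (n / 2) ℤ.+ j) × (weight w A ≈ γ))

DiamondFreeFamily : {p : Level} (n : ℕ) → (Subset n → Set p) → Set p
DiamondFreeFamily n 𝓕 = ∀ (A B C D : Subset n) →
  𝓕 A → 𝓕 B → 𝓕 C → 𝓕 D →
  ¬ (A ≡ B) → ¬ (A ≡ C) → ¬ (A ≡ D) → ¬ (B ≡ C) → ¬ (B ≡ D) → ¬ (C ≡ D) →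
  ¬ (A ⊆ B × B ⊆ D × A ⊆ C × C ⊆ D)

-- A chain A ⊂ B of the family lifts to Π i ≺ Π j for the layers i ∋ A and j ∋ B,
-- the sum of elements of H being the weights of B ∖ A.  Hence a diamond of
-- the family maps to a diamond of Π, unless its two middle sets B ≠ C lie in a
-- common layer.  Then they have equal size, so some x lies in B ∖ C, and the
-- layer chain of A ⊂ C ⊂ D is strong: the step A → C is also realised through
-- B ∖ A, and both B ∖ A and D ∖ C contain x, whose weight is the common term.
module Submission where

open import Defs
open import Level using (Level)
open import Algebra.Bundles using (AbelianGroup)
open import Data.Nat using (ℕ)
open import Data.Fin using (Fin)

open import Data.Nat as ℕ using (zero; suc)
import Data.Nat.Properties as ℕP
open import Data.Nat.DivMod using (_/_)
open import Data.Integer as ℤ using (+_)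
import Data.Integer.Properties as ℤP
open import Algebra.Properties.AbelianGroup ℤP.+-0-abelianGroup using (∙-cancelˡ)
open import Data.Fin using (zero; suc)
open import Data.Fin.Subset using (Subset; _⊆_; _∈_; _∉_; ∣_∣; inside; outside)
open import Data.Fin.Subset.Properties
  using (⊆-antisym; ⊆-trans; _⊆?_; s⊆s; out⊆; drop-∷-⊆; drop-there; p⊂q⇒∣p∣<∣q∣)
open import Data.Vec using ([]; _∷_; here; there)
import Data.Vec.Functional as Vector
open import Data.Product using (∃-syntax; _×_; _,_; proj₁; proj₂; map; map₂)
open import Function using (_∘_; id)
open import Relation.Binary.PropositionalEquality as ≡ using (_≡_; _≢_)
open import Relation.Nullary using (¬_; yes; no; contradiction)

⊈⇒∃∈∉ : ∀ {n} {p q : Subset n} → ¬ (p ⊆ q) → ∃[ x ] (x ∈ p × x ∉ q)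
⊈⇒∃∈∉ {p = []}          {[]}          p⊈q = contradiction (λ ()) p⊈q
⊈⇒∃∈∉ {p = inside ∷ p}  {outside ∷ q} _   = zero , here , λ ()
⊈⇒∃∈∉ {p = inside ∷ p}  {inside ∷ q}  p⊈q =
  map suc (map there (_∘ drop-there)) (⊈⇒∃∈∉ (p⊈q ∘ s⊆s))
⊈⇒∃∈∉ {p = outside ∷ p} {_ ∷ q}       p⊈q =
  map suc (map there (_∘ drop-there)) (⊈⇒∃∈∉ (p⊈q ∘ out⊆))

p⊆q∧∣p∣≡∣q∣⇒p≡q : ∀ {n} {p q : Subset n} → p ⊆ q → ∣ p ∣ ≡ ∣ q ∣ → p ≡ q
p⊆q∧∣p∣≡∣q∣⇒p≡q {p = p} {q} p⊆q ∣p∣≡∣q∣ with q ⊆? p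
... | yes q⊆p = ⊆-antisym p⊆q q⊆p
... | no  q⊈p = contradiction ∣p∣≡∣q∣ (ℕP.<⇒≢ (p⊂q⇒∣p∣<∣q∣ (p⊆q , ⊈⇒∃∈∉ q⊈p)))

∣p∣≡∣q∣∧p≢q⇒∃∈∉ : ∀ {n} {p q : Subset n} → ∣ p ∣ ≡ ∣ q ∣ → p ≢ q → ∃[ x ] (x ∈ p × x ∉ q)
∣p∣≡∣q∣∧p≢q⇒∃∈∉ {p = p} {q} ∣p∣≡∣q∣ p≢q with p ⊆? q
... | yes p⊆q = contradiction (p⊆q∧∣p∣≡∣q∣⇒p≡q p⊆q ∣p∣≡∣q∣) p≢q
... | no  p⊈q = ⊈⇒∃∈∉ p⊈q

module _ {c ℓ : Level} (G : AbelianGroup c ℓ) {h : ℕ} (η : Fin h → AbelianGroup.Carrier G) where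
  open AbelianGroup G

  record Extension {n : ℕ} (w : Fin n → Fin h) (A B : Subset n) : Set ℓ where
    field
      size     : ℕ
      terms    : Fin size → Fin h
      ∣∣-+     : ∣ B ∣ ≡ ∣ A ∣ ℕ.+ size
      weight-∙ : weight G η w B ≈ weight G η w A ∙ sumF G size (η ∘ terms)
      covers   : ∀ {x} → x ∈ B → x ∉ A → ∃[ t ] (terms t ≡ w x)

  extension : ∀ {n} (w : Fin n → Fin h) {A B : Subset n} → A ⊆ B → Extension w A B
  extension w {[]} {[]} _ = record
    { size = 0 ; terms = λ () ; ∣∣-+ = ≡.refl ; weight-∙ = sym (identityʳ ε) ; covers = λ () }
  extension w {inside ∷ A} {outside ∷ B} A⊆B = contradiction (A⊆B here) λ ()
  extension w {inside ∷ A} {inside ∷ B} A⊆B = record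
    { size = size ; terms = terms ; ∣∣-+ = ≡.cong suc ∣∣-+
    ; weight-∙ = trans (∙-congˡ weight-∙) (sym (assoc _ _ _))
    ; covers = λ { here x∉A → contradiction here x∉A
                 ; (there x∈B) x∉A → covers x∈B (x∉A ∘ there) } }
    where open Extension (extension (w ∘ suc) (drop-∷-⊆ A⊆B))
  extension w {outside ∷ A} {outside ∷ B} A⊆B = record
    { size = size ; terms = terms ; ∣∣-+ = ∣∣-+ ; weight-∙ = weight-∙
    ; covers = λ { (there x∈B) x∉A → covers x∈B (x∉A ∘ there) } }
    where open Extension (extension (w ∘ suc) (drop-∷-⊆ A⊆B))
  extension w {outside ∷ A} {inside ∷ B} A⊆B = record
    { size = suc size ; terms = w zero Vector.∷ terms
    ; ∣∣-+ = ≡.trans (≡.cong suc ∣∣-+) (≡.sym (ℕP.+-suc _ size))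
    ; weight-∙ = begin
        a ∙ weight G η (w ∘ suc) B        ≈⟨ ∙-congˡ weight-∙ ⟩
        a ∙ (weight G η (w ∘ suc) A ∙ S)  ≈⟨ sym (assoc _ _ _) ⟩
        (a ∙ weight G η (w ∘ suc) A) ∙ S  ≈⟨ ∙-congʳ (comm _ _) ⟩
        (weight G η (w ∘ suc) A ∙ a) ∙ S  ≈⟨ assoc _ _ _ ⟩
        weight G η (w ∘ suc) A ∙ (a ∙ S)  ∎
    ; covers = λ { here _ → zero , ≡.refl
                 ; (there x∈B) x∉A → map suc id (covers x∈B (x∉A ∘ there)) } }
    where
      open Extension (extension (w ∘ suc) (drop-∷-⊆ A⊆B))
      open import Relation.Binary.Reasoning.Setoid setoid
      a S : Carrier
      a = η (w zero)
      S = sumF G size (η ∘ terms)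

  module Layers (n : ℕ) (w : Fin n → Fin h) (l : ℕ) (Π : Fin l → Elem G η) where

    _∈Layer_ : Subset n → Fin l → Set ℓ
    A ∈Layer i = (+ ∣ A ∣ ≡ + (n / 2) ℤ.+ proj₂ (Π i)) × (weight G η w A ≈ proj₁ (Π i))

    ∈Layer-resp-≋ : ∀ {A i j} → A ∈Layer i → _≋_ G η (Π i) (Π j) → A ∈Layer j
    ∈Layer-resp-≋ (∣A∣≡ , wA≈) (γ≈ , j≡) =
      ≡.trans ∣A∣≡ (≡.cong (ℤ._+_ (+ (n / 2))) j≡) , trans wA≈ γ≈

    ∈Layer⇒∣∣≡ : ∀ {A B i} → A ∈Layer i → B ∈Layer i → ∣ A ∣ ≡ ∣ B ∣
    ∈Layer⇒∣∣≡ (∣A∣≡ , _) (∣B∣≡ , _) = ℤP.+-injective (≡.trans ∣A∣≡ (≡.sym ∣B∣≡))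

    ∈Layer⇒level-+ : ∀ {A B i j k} → A ∈Layer i → B ∈Layer j → ∣ B ∣ ≡ ∣ A ∣ ℕ.+ k →
      proj₂ (Π j) ≡ proj₂ (Π i) ℤ.+ + k
    ∈Layer⇒level-+ {A} {B} {i} {j} {k} (∣A∣≡ , _) (∣B∣≡ , _) ∣B∣≡∣A∣+k =
      ∙-cancelˡ (+ (n / 2)) _ _ (begin
        + (n / 2) ℤ.+ proj₂ (Π j)                 ≡⟨ ≡.sym ∣B∣≡ ⟩
        + ∣ B ∣                                   ≡⟨ ≡.cong +_ ∣B∣≡∣A∣+k ⟩
        + (∣ A ∣ ℕ.+ k)                           ≡⟨ ℤP.pos-+ ∣ A ∣ k ⟩
        + ∣ A ∣ ℤ.+ + k                           ≡⟨ ≡.cong (ℤ._+ + k) ∣A∣≡ ⟩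
        + (n / 2) ℤ.+ proj₂ (Π i) ℤ.+ + k         ≡⟨ ℤP.+-assoc (+ (n / 2)) (proj₂ (Π i)) (+ k) ⟩
        + (n / 2) ℤ.+ (proj₂ (Π i) ℤ.+ + k)       ∎)
      where open ≡.≡-Reasoning

    ∈Layer⇒weight-∙ : ∀ {A B i j s} → A ∈Layer i → B ∈Layer j →
      weight G η w B ≈ weight G η w A ∙ s → proj₁ (Π j) ≈ proj₁ (Π i) ∙ s
    ∈Layer⇒weight-∙ (_ , wA≈) (_ , wB≈) wB≈wA∙s = trans (sym wB≈) (trans wB≈wA∙s (∙-congʳ wA≈))

    ⊆⇒⪯ : ∀ {A B i j} → A ⊆ B → A ∈Layer i → B ∈Layer j → _⪯_ G η (Π i) (Π j)
    ⊆⇒⪯ A⊆B A∈i B∈j = size , ∈Layer⇒level-+ A∈i B∈j ∣∣-+ , terms , ∈Layer⇒weight-∙ A∈i B∈j weight-∙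
      where open Extension (extension w A⊆B)

    ⊆⇒SumStepWith : ∀ {A B i j x} → A ⊆ B → A ∈Layer i → B ∈Layer j → x ∈ B → x ∉ A →
      ∃[ k ] (proj₂ (Π j) ≡ proj₂ (Π i) ℤ.+ + k × SumStepWith G η (w x) (proj₁ (Π i)) k (proj₁ (Π j)))
    ⊆⇒SumStepWith A⊆B A∈i B∈j x∈B x∉A =
      size , ∈Layer⇒level-+ A∈i B∈j ∣∣-+ , terms ,
      map₂ (reflexive ∘ ≡.cong η) (covers x∈B x∉A) , ∈Layer⇒weight-∙ A∈i B∈j weight-∙
      where open Extension (extension w A⊆B)

    ⊂⇒≉ : ∀ {A B i j} → A ⊆ B → A ≢ B → A ∈Layer i → B ∈Layer j → ¬ _≋_ G η (Π i) (Π j)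
    ⊂⇒≉ A⊆B A≢B A∈i B∈j Πᵢ≋Πⱼ =
      A≢B (p⊆q∧∣p∣≡∣q∣⇒p≡q A⊆B (∈Layer⇒∣∣≡ (∈Layer-resp-≋ A∈i Πᵢ≋Πⱼ) B∈j))

    ⊂⇒≺ : ∀ {A B i j} → A ⊆ B → A ≢ B → A ∈Layer i → B ∈Layer j → _≺_ G η (Π i) (Π j)
    ⊂⇒≺ A⊆B A≢B A∈i B∈j = ⊆⇒⪯ A⊆B A∈i B∈j , ⊂⇒≉ A⊆B A≢B A∈i B∈j

    diamond-with-equal-layers⇒StrongChain : ∀ {A B C D a c d} →
      A ⊆ B → A ⊆ C → B ⊆ D → C ⊆ D → A ≢ C → C ≢ D → A ≢ D → B ≢ C →
      A ∈Layer a → B ∈Layer c → C ∈Layer c → D ∈Layer d →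
      StrongChain G η (Π a) (Π c) (Π d)
    diamond-with-equal-layers⇒StrongChain A⊆B A⊆C B⊆D C⊆D A≢C C≢D A≢D B≢C A∈a B∈c C∈c D∈d
      with x , x∈B , x∉C ← ∣p∣≡∣q∣∧p≢q⇒∃∈∉ (∈Layer⇒∣∣≡ B∈c C∈c) B≢C =
      ⊂⇒≺ A⊆C A≢C A∈a C∈c , ⊂⇒≺ C⊆D C≢D C∈c D∈d , ⊂⇒≉ (⊆-trans A⊆C C⊆D) A≢D A∈a D∈d ,
      w x , ⊆⇒SumStepWith A⊆B A∈a B∈c x∈B (x∉C ∘ A⊆C) , ⊆⇒SumStepWith C⊆D C∈c D∈d (B⊆D x∈B) x∉C

lemma1 : {c ℓ : Level} (G : AbelianGroup c ℓ) → IsFinite G →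
    (h : ℕ) (η : Fin h → AbelianGroup.Carrier G) → Generates G h η →
    (l : ℕ) (Π : Fin l → Elem G η) → StronglyDiamondFree G η l Π →
    (n : ℕ) (w : Fin n → Fin h) →
    DiamondFreeFamily n (InF G η n w l Π)
lemma1 G _ h η _ l Π (diamondFree , noStrongChain) n w A B C D (a , A∈a) (b , B∈b) (c , C∈c) (d , D∈d)
  A≢B A≢C A≢D B≢C B≢D C≢D (A⊆B , B⊆D , A⊆C , C⊆D) =
  diamondFree a b c d
    (⊂⇒≉ A⊆B A≢B A∈a B∈b) (⊂⇒≉ A⊆C A≢C A∈a C∈c) (⊂⇒≉ (⊆-trans A⊆B B⊆D) A≢D A∈a D∈d)
    Πb≉Πc (⊂⇒≉ B⊆D B≢D B∈b D∈d) (⊂⇒≉ C⊆D C≢D C∈c D∈d)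
    (⊆⇒⪯ A⊆B A∈a B∈b , ⊆⇒⪯ B⊆D B∈b D∈d , ⊆⇒⪯ A⊆C A∈a C∈c , ⊆⇒⪯ C⊆D C∈c D∈d)
  where
    open Layers G η n w l Π
    Πb≉Πc : ¬ _≋_ G η (Π b) (Π c)
    Πb≉Πc Πb≋Πc = noStrongChain a c d (diamond-with-equal-layers⇒StrongChain
      A⊆B A⊆C B⊆D C⊆D A≢C C≢D A≢D B≢C A∈a (∈Layer-resp-≋ B∈b Πb≋Πc) C∈c D∈d)
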